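{- For every integer $n\ge 5$ and every graph $G$ obtained from the complete graph $K_n$ by removing any two edges, $c_H(G)\le \lceil n/2\rceil-1$.
   Context: Hyperopic Cops and Robbers on a finite connected simple graph $G$: one player controls $k$ cops, the other a single robber. The cops first choose starting vertices (several cops may share a vertex), then the robber chooses a starting vertex; afterwards, in each round, each cop moves to an adjacent vertex or stays put, and then the robber moves to an adjacent vertex or stays put. The robber always knows the cops' positions. The robber is invisible to the cops exactly when the robber's vertex is adjacent to the vertex of every cop (a robber on the same vertex as a cop is visible); otherwise the cops see the robber's position. The cops win if after finitely many rounds some cop occupies the robber's vertex, and the cops' strategy must guarantee this with certainty (no chance allowed). The hyperopic cop number $c_H(G)$ is the minimum $k$ for which $k$ cops have a winning strategy. -}

module Defs where

open import Data.Nat using (ℕ; zero; suc)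
open import Data.Fin using (Fin; _≟_)
open import Data.Fin.Properties using (all?)
open import Data.Maybe using (Maybe; just; nothing)
open import Data.List using (List; []; _∷_)
open import Data.Product using (Σ; _×_; _,_; proj₁; proj₂; ∃-syntax)
open import Data.Sum using (_⊎_; inj₁; inj₂)
open import Relation.Nullary using (¬_; Dec; yes; no)
open import Relation.Nullary.Decidable using (¬?; _×-dec_; _⊎-dec_)
open import Relation.Binary.PropositionalEquality using (_≡_; refl)
open import Relation.Binary.Definitions using (Decidable)

record SimpleGraph (n : ℕ) : Set₁ where
  field
    Adj    : Fin n → Fin n → Set
    adj?   : Decidable Adj
    sym    : ∀ {x y} → Adj x y → Adj y x
    irrefl : ∀ {x} → ¬ Adj x x

open SimpleGraph public

SameEdge : ∀ {n} → Fin n → Fin n → Fin n → Fin n → Set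
SameEdge a b x y = (x ≡ a × y ≡ b) ⊎ (x ≡ b × y ≡ a)

sameEdge? : ∀ {n} (a b x y : Fin n) → Dec (SameEdge a b x y)
sameEdge? a b x y = ((x ≟ a) ×-dec (y ≟ b)) ⊎-dec ((x ≟ b) ×-dec (y ≟ a))

sameEdge-sym : ∀ {n} {a b x y : Fin n} → SameEdge a b x y → SameEdge a b y x
sameEdge-sym (inj₁ (p , q)) = inj₂ (q , p)
sameEdge-sym (inj₂ (p , q)) = inj₁ (q , p)

KnMinus2Adj : ∀ {n} → Fin n → Fin n → Fin n → Fin n → Fin n → Fin n → Set
KnMinus2Adj a b c d x y = ¬ x ≡ y × ¬ SameEdge a b x y × ¬ SameEdge c d x y

KnMinus2 : (n : ℕ) → (a b c d : Fin n) → SimpleGraph n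
KnMinus2 n a b c d = record
  { Adj    = KnMinus2Adj a b c d
  ; adj?   = λ x y → ¬? (x ≟ y) ×-dec (¬? (sameEdge? a b x y) ×-dec ¬? (sameEdge? c d x y))
  ; sym    = λ { (p , q , r) → (λ e → p (symm e)) , (λ e → q (sameEdge-sym e)) , (λ e → r (sameEdge-sym e)) }
  ; irrefl = λ { (p , _) → p refl }
  }
  where
  symm : ∀ {x y : Fin n} → x ≡ y → y ≡ x
  symm refl = refl

-- Hyperopic Cops and Robbers

Config : ℕ → ℕ → Set
Config n k = Fin k → Fin n

-- what the cops observe: nothing if the robber is adjacent to every cop
-- (invisible), otherwise the robber's vertex
Obs : ℕ → Set
Obs n = Maybe (Fin n)

view : ∀ {n k} → SimpleGraph n → Config n k → Fin n → Obs n
view G c v with all? (λ i → adj? G (c i) v)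
... | yes _ = nothing
... | no  _ = just v

-- a deterministic cop strategy: from the history of all observations so far
-- (most recent first) to the cops' next positions; on the empty history it
-- gives the initial placement
Strategy : ℕ → ℕ → Set
Strategy n k = List (Obs n) → Config n k

RobberWalk : ∀ {n} → SimpleGraph n → (ℕ → Fin n) → Set
RobberWalk G r = ∀ t → r (suc t) ≡ r t ⊎ Adj G (r t) (r (suc t))

-- state at time t (after the robber's t-th placement/move):
-- cops' positions and the observation history.
-- Round t+1: cops move (according to the history), cops observe the robber
-- w.r.t. their new positions, robber moves, cops observe again.
play : ∀ {n k} → SimpleGraph n → Strategy n k → (ℕ → Fin n) → ℕ → Config n k × List (Obs n)
play G σ r zero = σ [] , (view G (σ []) (r zero) ∷ [])
play G σ r (suc t) =
  let h  = proj₂ (play G σ r t)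
      c' = σ h
  in c' , (view G c' (r (suc t)) ∷ view G c' (r t) ∷ h)

cops : ∀ {n k} → SimpleGraph n → Strategy n k → (ℕ → Fin n) → ℕ → Config n k
cops G σ r t = proj₁ (play G σ r t)

LegalCops : ∀ {n k} → SimpleGraph n → Strategy n k → (ℕ → Fin n) → Set
LegalCops {k = k} G σ r =
  ∀ t (i : Fin k) → cops G σ r (suc t) i ≡ cops G σ r t i ⊎ Adj G (cops G σ r t i) (cops G σ r (suc t) i)

-- capture: at some time a cop is on the robber's vertex, either after the
-- robber's move or after the cops' move of the following round
Captured : ∀ {n k} → SimpleGraph n → Strategy n k → (ℕ → Fin n) → Set
Captured {k = k} G σ r =
  ∃[ t ] ∃[ i ] (cops G σ r t i ≡ r t ⊎ cops G σ r (suc t) i ≡ r t)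

CopsWin : ∀ {n} → SimpleGraph n → ℕ → Set
CopsWin {n} G k =
  Σ (Strategy n k) λ σ → ∀ (r : ℕ → Fin n) → RobberWalk G r → LegalCops G σ r × Captured G σ r

-- Put two cops on vertices p and r that together dominate the graph, and let
-- the remaining cops and one "partner" vertex per cop cover every vertex except
-- two vertices q and s that are not common neighbours of p and r. A robber that
-- is seen is on or next to a cop and is caught at once. An invisible robber is
-- adjacent to every cop, so it is neither on a cop nor on q or s: it sits on a
-- partner vertex, and every cop simply steps to its partner. Either way the
-- robber is caught before it ever moves. The n - 2 vertices other than q and s
-- are covered by k cops with partners once n ≤ 2k + 2, i.e. k = ⌈n/2⌉ - 1.
-- In K_n minus the edges {a,b} and {c,d}: if the edges are disjoint take
-- p, q, r, s = a, b, c, d; if they share an endpoint take it as p, the two other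
-- endpoints as q and s, and as r any vertex off both edges, which exists as n ≥ 5.
module Submission where

open import Defs hiding (sym)
open import Data.Nat using (ℕ; _≤_; _∸_; ⌈_/2⌉)
open import Data.Fin using (Fin)
open import Data.Product using (_×_; ∃-syntax)
open import Relation.Nullary using (¬_)
open import Relation.Binary.PropositionalEquality using (_≡_)

open import Data.Nat using (suc; _+_; _<_; _<?_; s≤s)
open import Data.Nat.Properties
  using (≤-refl; <⇒≤; ≮⇒≥; <-≤-trans; +-monoˡ-≤; +-cancelˡ-<; m+[n∸m]≡n; ∸-monoˡ-≤;
         ⌊n/2⌋≤⌈n/2⌉; ⌊n/2⌋+⌈n/2⌉≡n; ⌈n/2⌉-mono)
open import Data.Fin using (zero; suc; toℕ; fromℕ<; _↑ʳ_; _≟_)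
open import Data.Fin.Patterns using (0F; 1F; 2F; 3F)
open import Data.Fin.Properties using (toℕ<n; toℕ-fromℕ<; fromℕ<-toℕ; ¬∀⟶∃¬; pigeonhole; <⇒≢; all?)
open import Data.Fin.Permutation using (Permutation′; _⟨$⟩ʳ_; _⟨$⟩ˡ_; inverseʳ; id; _∘ₚ_; transpose)
import Data.Fin.Permutation.Components as PC
open import Data.List using (List; []; _∷_; map; length; lookup; last)
open import Data.List.Relation.Unary.All as All using (All; []; _∷_)
open import Data.List.Relation.Unary.All.Properties using (map⁻)
open import Data.List.Relation.Unary.AllPairs using ([]; _∷_)
open import Data.List.Relation.Unary.Any using (here; there; index)
open import Data.List.Relation.Unary.Any.Properties using (lookup-index)
open import Data.List.Relation.Unary.Unique.Propositional using (Unique)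
open import Data.List.Membership.Propositional using (_∈_; _∉_)
open import Data.Maybe using (just; nothing; maybe′)
open import Data.Product using (_,_; proj₁; proj₂)
open import Data.Sum using (_⊎_; inj₁; inj₂)
open import Function using (_∘_)
open import Function.Bundles using (Injection)
open import Function.Properties.Inverse using (↔⇒↣)
open import Relation.Nullary using (yes; no; contradiction)
open import Relation.Binary.PropositionalEquality using (_≢_; ≢-sym; refl; sym; trans; cong; subst; module ≡-Reasoning)

module _ {n : ℕ} (G : SimpleGraph n) where

  stepTowards : Fin n → Fin n → Fin n
  stepTowards x y with adj? G x y
  ... | yes _ = y
  ... | no  _ = x

  stepTowards-legal : ∀ x y → stepTowards x y ≡ x ⊎ Adj G x (stepTowards x y)
  stepTowards-legal x y with adj? G x y
  ... | yes x~y = inj₂ x~y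
  ... | no  _   = inj₁ refl

  stepTowards-reaches : ∀ {x y} → Adj G x y → stepTowards x y ≡ y
  stepTowards-reaches {x} {y} x~y with adj? G x y
  ... | yes _   = refl
  ... | no  x≁y = contradiction x~y x≁y

  view-cases : ∀ {k} (C : Config n k) v →
               (view G C v ≡ nothing × (∀ i → Adj G (C i) v)) ⊎ view G C v ≡ just v
  view-cases C v with all? (λ i → adj? G (C i) v)
  ... | yes all~ = inj₁ (refl , all~)
  ... | no  _    = inj₂ refl

  module _ {k : ℕ} (start : Config n k) (react : Obs n → Config n k) where

    reactToFirstView : Strategy n k
    reactToFirstView history = maybe′ react start (last history)

    private
      firstView : (ℕ → Fin n) → Obs n
      firstView robber = view G start (robber 0)

      last-history : ∀ robber t o →
        last (o ∷ proj₂ (play G reactToFirstView robber t)) ≡ just (firstView robber)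
      last-history robber 0       o = refl
      last-history robber (suc t) o = last-history robber t _

      cops-react : ∀ robber t → cops G reactToFirstView robber (suc t) ≡ react (firstView robber)
      cops-react robber 0       = refl
      cops-react robber (suc t) = cong (maybe′ react start) (last-history robber t _)

    copsWin-inOneRound :
      (∀ o i → react o i ≡ start i ⊎ Adj G (start i) (react o i)) →
      (∀ v → ∃[ i ] (start i ≡ v ⊎ react (view G start v) i ≡ v)) →
      CopsWin G k
    copsWin-inOneRound legal catches =
      reactToFirstView , λ robber _ → legality robber , (0 , catches (robber 0))
      where
      legality : ∀ robber → LegalCops G reactToFirstView robber
      legality robber 0       i = legal (firstView robber) i
      legality robber (suc t) i =
        inj₁ (cong (λ C → C i) (trans (cops-react robber (suc t)) (sym (cops-react robber t))))

  Dominating : ∀ {k} → Config n k → Set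
  Dominating C = ∀ v → ∃[ i ] (C i ≡ v ⊎ Adj G (C i) v)

  copsWin-withPartners : ∀ {k} (cop partner : Config n k) → Dominating cop →
    (∀ v → (∀ i → Adj G (cop i) v) → ∃[ i ] partner i ≡ v) → CopsWin G k
  copsWin-withPartners {k} cop partner dominating partnered =
    copsWin-inOneRound cop react legal catches
    where
    react : Obs n → Config n k
    react nothing  i = stepTowards (cop i) (partner i)
    react (just v) i = stepTowards (cop i) v

    legal : ∀ o i → react o i ≡ cop i ⊎ Adj G (cop i) (react o i)
    legal nothing  i = stepTowards-legal (cop i) (partner i)
    legal (just v) i = stepTowards-legal (cop i) v

    catches : ∀ v → ∃[ i ] (cop i ≡ v ⊎ react (view G cop v) i ≡ v)
    catches v with view G cop v | view-cases cop v
    ... | .nothing | inj₁ (refl , cops~v) with partnered v cops~v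
    ...   | i , refl = i , inj₂ (stepTowards-reaches (cops~v i))
    catches v | .(just v) | inj₂ refl with dominating v
    ...   | i , inj₁ cop≡v = i , inj₁ cop≡v
    ...   | i , inj₂ cop~v = i , inj₂ (stepTowards-reaches cop~v)

transpose-left : ∀ {n} (i j : Fin n) → PC.transpose i j i ≡ j
transpose-left i j with i ≟ i
... | yes _   = refl
... | no  i≢i = contradiction refl i≢i

transpose-fixes : ∀ {n} {i j k : Fin n} → k ≢ i → k ≢ j → PC.transpose i j k ≡ k
transpose-fixes {i = i} {j} {k} k≢i k≢j with k ≟ i
... | yes k≡i = contradiction k≡i k≢i
... | no  _ with k ≟ j
...   | yes k≡j = contradiction k≡j k≢j
...   | no  _   = refl

Sends : ∀ {n} → Permutation′ n → Fin n × Fin n → Set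
Sends π (x , y) = π ⟨$⟩ʳ x ≡ y

extendToPermutation : ∀ {n} (ps : List (Fin n × Fin n)) →
  Unique (map proj₁ ps) → Unique (map proj₂ ps) → ∃[ π ] All (Sends π) ps
extendToPermutation [] _ _ = id , []
extendToPermutation {n} ((x , y) ∷ ps) (x∉xs ∷ xs-unique) (y∉ys ∷ ys-unique)
  with π , π-sends ← extendToPermutation ps xs-unique ys-unique =
  π′ , transpose-left (π ⟨$⟩ʳ x) y ∷ All.zipWith still-sends (π-sends , All.zip (map⁻ x∉xs , map⁻ y∉ys))
  where
  π′ : Permutation′ n
  π′ = π ∘ₚ transpose (π ⟨$⟩ʳ x) y

  still-sends : ∀ {xy} → Sends π xy × (x ≢ proj₁ xy × y ≢ proj₂ xy) → Sends π′ xy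
  still-sends {x′ , y′} (πx′≡y′ , x≢x′ , y≢y′) = begin
    PC.transpose (π ⟨$⟩ʳ x) y (π ⟨$⟩ʳ x′)
      ≡⟨ transpose-fixes (x≢x′ ∘ sym ∘ Injection.injective (↔⇒↣ π))
                         (λ πx′≡y → y≢y′ (trans (sym πx′≡y) πx′≡y′)) ⟩
    π ⟨$⟩ʳ x′
      ≡⟨ πx′≡y′ ⟩
    y′ ∎
    where open ≡-Reasoning

-- Slot j stands for index 2 + j, leaving indices 0 and 1 for the two uncovered
-- vertices; a slot beyond the last vertex (only possible when n < 2k + 2) is
-- parked on index 0.
module _ {m : ℕ} where

  slotIndex : ℕ → Fin (2 + m)
  slotIndex j with j <? m
  ... | yes j<m = 2 ↑ʳ fromℕ< j<m
  ... | no  _   = zero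

  slotIndex-toℕ : (j : Fin m) → slotIndex (toℕ j) ≡ 2 ↑ʳ j
  slotIndex-toℕ j with toℕ j <? m
  ... | yes j<m = cong (2 ↑ʳ_) (fromℕ<-toℕ j j<m)
  ... | no  j≮m = contradiction (toℕ<n j) j≮m

  slotIndex-cover : ∀ {k} → m ≤ k + k → (j : Fin m) →
    ∃[ i ] (slotIndex (toℕ {k} i) ≡ 2 ↑ʳ j ⊎ slotIndex (k + toℕ i) ≡ 2 ↑ʳ j)
  slotIndex-cover {k} m≤2k j with toℕ j <? k
  ... | yes j<k = fromℕ< j<k , inj₁ (trans (cong slotIndex (toℕ-fromℕ< j<k)) (slotIndex-toℕ j))
  ... | no  j≮k = fromℕ< j∸k<k , inj₂ (trans (cong slotIndex k+i≡j) (slotIndex-toℕ j))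
    where
    k+[j∸k]≡j : k + (toℕ j ∸ k) ≡ toℕ j
    k+[j∸k]≡j = m+[n∸m]≡n (≮⇒≥ j≮k)
    j∸k<k : toℕ j ∸ k < k
    j∸k<k = +-cancelˡ-< k _ k (subst (_< k + k) (sym k+[j∸k]≡j) (<-≤-trans (toℕ<n j) m≤2k))
    k+i≡j : k + toℕ (fromℕ< j∸k<k) ≡ toℕ j
    k+i≡j = trans (cong (k +_) (toℕ-fromℕ< j∸k<k)) k+[j∸k]≡j

record Anchors {n} (G : SimpleGraph n) : Set where
  field
    p r q s    : Fin n
    distinct   : Unique (p ∷ r ∷ q ∷ s ∷ [])
    dominating : ∀ v → v ≢ p → v ≢ r → Adj G p v ⊎ Adj G r v
    q-apart    : ¬ (Adj G p q × Adj G r q)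
    s-apart    : ¬ (Adj G p s × Adj G r s)

module AnchoredPairs {n k : ℕ} {G : SimpleGraph (4 + n)} (A : Anchors G) (π : Permutation′ (4 + n))
         (π2≡p : π ⟨$⟩ʳ 2F ≡ Anchors.p A) (π3≡r : π ⟨$⟩ʳ 3F ≡ Anchors.r A)
         (π0≡q : π ⟨$⟩ʳ 0F ≡ Anchors.q A) (π1≡s : π ⟨$⟩ʳ 1F ≡ Anchors.s A)
         where
  open Anchors A

  cop partner : Config (4 + n) (2 + k)
  cop     i = π ⟨$⟩ʳ slotIndex (toℕ i)
  partner i = π ⟨$⟩ʳ slotIndex (2 + k + toℕ i)

  cop-p : cop 0F ≡ p
  cop-p = trans (cong (π ⟨$⟩ʳ_) (slotIndex-toℕ 0F)) π2≡p

  cop-r : cop 1F ≡ r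
  cop-r = trans (cong (π ⟨$⟩ʳ_) (slotIndex-toℕ 1F)) π3≡r

  cop-dominating : Dominating G cop
  cop-dominating v with v ≟ p | v ≟ r
  ... | yes v≡p | _       = 0F , inj₁ (trans cop-p (sym v≡p))
  ... | no  _   | yes v≡r = 1F , inj₁ (trans cop-r (sym v≡r))
  ... | no  v≢p | no  v≢r with dominating v v≢p v≢r
  ...   | inj₁ p~v = 0F , inj₂ (subst (λ x → Adj G x v) (sym cop-p) p~v)
  ...   | inj₂ r~v = 1F , inj₂ (subst (λ x → Adj G x v) (sym cop-r) r~v)

  commonNeighbour-partner : 2 + n ≤ (2 + k) + (2 + k) →
    ∀ v → (∀ i → Adj G (cop i) v) → ∃[ i ] partner i ≡ v
  commonNeighbour-partner slots-fit v cops~v = locate (π ⟨$⟩ˡ v) (inverseʳ π)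
    where
    p~v : Adj G p v
    p~v = subst (λ x → Adj G x v) cop-p (cops~v 0F)

    r~v : Adj G r v
    r~v = subst (λ x → Adj G x v) cop-r (cops~v 1F)

    not-at : ∀ {x} → ¬ (Adj G p x × Adj G r x) → x ≢ v
    not-at apart refl = apart (p~v , r~v)

    locate : ∀ j → π ⟨$⟩ʳ j ≡ v → ∃[ i ] partner i ≡ v
    locate 0F π0≡v = contradiction (trans (sym π0≡q) π0≡v) (not-at q-apart)
    locate 1F π1≡v = contradiction (trans (sym π1≡s) π1≡v) (not-at s-apart)
    locate (suc (suc j)) πj≡v with slotIndex-cover slots-fit j
    ... | i , inj₁ cop-slot = contradiction
            (subst (λ x → Adj G x v) (trans (cong (π ⟨$⟩ʳ_) cop-slot) πj≡v) (cops~v i)) (irrefl G)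
    ... | i , inj₂ partner-slot = i , trans (cong (π ⟨$⟩ʳ_) partner-slot) πj≡v

copsWin-anchors : ∀ {n k} {G : SimpleGraph n} → Anchors G → 4 ≤ n → 2 ≤ k → n ≤ 2 + (k + k) → CopsWin G k
copsWin-anchors {k = k} {G = G} A (s≤s (s≤s (s≤s (s≤s _)))) (s≤s (s≤s _)) (s≤s (s≤s slots-fit)) =
  pairUp (extendToPermutation ((2F , p) ∷ (3F , r) ∷ (0F , q) ∷ (1F , s) ∷ []) indices-distinct distinct)
  where
  open Anchors A

  indices-distinct : Unique (2F ∷ 3F ∷ 0F ∷ 1F ∷ [])
  indices-distinct = ((λ ()) ∷ (λ ()) ∷ (λ ()) ∷ []) ∷ ((λ ()) ∷ (λ ()) ∷ []) ∷ ((λ ()) ∷ []) ∷ [] ∷ []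

  pairUp : ∃[ π ] All (Sends π) ((2F , p) ∷ (3F , r) ∷ (0F , q) ∷ (1F , s) ∷ []) → CopsWin G k
  pairUp (π , π2≡p ∷ π3≡r ∷ π0≡q ∷ π1≡s ∷ []) =
    copsWin-withPartners G cop partner cop-dominating (commonNeighbour-partner slots-fit)
    where open AnchoredPairs A π π2≡p π3≡r π0≡q π1≡s

∃-∉ : ∀ {n} (xs : List (Fin n)) → length xs < n → ∃[ v ] v ∉ xs
∃-∉ {n} xs |xs|<n = ¬∀⟶∃¬ n (_∈ xs) (_∈? xs) not-all-∈
  where
  open import Data.List.Membership.DecPropositional (_≟_ {n}) using (_∈?_)

  not-all-∈ : ¬ (∀ v → v ∈ xs)
  not-all-∈ all-∈ with i , j , i<j , same-index ← pigeonhole |xs|<n (index ∘ all-∈) =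
    <⇒≢ i<j (begin
      i                             ≡⟨ lookup-index (all-∈ i) ⟩
      lookup xs (index (all-∈ i))   ≡⟨ cong (lookup xs) same-index ⟩
      lookup xs (index (all-∈ j))   ≡⟨ lookup-index (all-∈ j) ⟨
      j                             ∎)
    where open ≡-Reasoning

¬SameEdgeˡ : ∀ {n} {u w x y : Fin n} → x ≢ u → x ≢ w → ¬ SameEdge u w x y
¬SameEdgeˡ x≢u _   (inj₁ (x≡u , _)) = x≢u x≡u
¬SameEdgeˡ _   x≢w (inj₂ (x≡w , _)) = x≢w x≡w

¬SameEdgeʳ : ∀ {n} {u w x y : Fin n} → y ≢ u → y ≢ w → ¬ SameEdge u w x y
¬SameEdgeʳ _   y≢w (inj₁ (_ , y≡w)) = y≢w y≡w
¬SameEdgeʳ y≢u _   (inj₂ (_ , y≡u)) = y≢u y≡u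

≢-endpoints : ∀ {n} {u w x y z : Fin n} → z ≢ u → z ≢ w → SameEdge u w x y → z ≢ x × z ≢ y
≢-endpoints z≢u z≢w (inj₁ (refl , refl)) = z≢u , z≢w
≢-endpoints z≢u z≢w (inj₂ (refl , refl)) = z≢w , z≢u

module _ {n : ℕ} {a b c d : Fin n} where

  private
    G : SimpleGraph n
    G = KnMinus2 n a b c d

  anchors-disjoint : a ≢ b → c ≢ d → a ≢ c → a ≢ d → b ≢ c → b ≢ d → Anchors G
  anchors-disjoint a≢b c≢d a≢c a≢d b≢c b≢d = record
    { p = a ; r = c ; q = b ; s = d
    ; distinct   = (a≢c ∷ a≢b ∷ a≢d ∷ []) ∷ (≢-sym b≢c ∷ c≢d ∷ []) ∷ (b≢d ∷ []) ∷ [] ∷ []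
    ; dominating = dominating
    ; q-apart    = λ (a~b , _) → proj₁ (proj₂ a~b) (inj₁ (refl , refl))
    ; s-apart    = λ (_ , c~d) → proj₂ (proj₂ c~d) (inj₁ (refl , refl))
    }
    where
    dominating : ∀ v → v ≢ a → v ≢ c → Adj G a v ⊎ Adj G c v
    dominating v v≢a v≢c with v ≟ b
    ... | yes refl = inj₂ (≢-sym b≢c , ¬SameEdgeˡ (≢-sym a≢c) (≢-sym b≢c) , ¬SameEdgeʳ b≢c b≢d)
    ... | no  v≢b  = inj₁ (≢-sym v≢a , ¬SameEdgeʳ v≢a v≢b , ¬SameEdgeˡ a≢c a≢d)

  anchors-shared : 4 < n → (x y z : Fin n) → x ≢ y → x ≢ z → y ≢ z →
                   SameEdge a b x y → SameEdge c d x z → Anchors G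
  anchors-shared 4<n x y z x≢y x≢z y≢z ab=xy cd=xz
    with u , u∉abcd ← ∃-∉ (a ∷ b ∷ c ∷ d ∷ []) 4<n = record
    { p = x ; r = u ; q = y ; s = z
    ; distinct   = (≢-sym u≢x ∷ x≢y ∷ x≢z ∷ []) ∷ (u≢y ∷ u≢z ∷ []) ∷ (y≢z ∷ []) ∷ [] ∷ []
    ; dominating = λ v _ v≢u → inj₂ (≢-sym v≢u , ¬SameEdgeˡ u≢a u≢b , ¬SameEdgeˡ u≢c u≢d)
    ; q-apart    = λ (x~y , _) → proj₁ (proj₂ x~y) ab=xy
    ; s-apart    = λ (x~z , _) → proj₂ (proj₂ x~z) cd=xz
    }
    where
    u≢a : u ≢ a
    u≢a = u∉abcd ∘ here
    u≢b : u ≢ b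
    u≢b = u∉abcd ∘ there ∘ here
    u≢c : u ≢ c
    u≢c = u∉abcd ∘ there ∘ there ∘ here
    u≢d : u ≢ d
    u≢d = u∉abcd ∘ there ∘ there ∘ there ∘ here
    u≢x×u≢y : u ≢ x × u ≢ y
    u≢x×u≢y = ≢-endpoints u≢a u≢b ab=xy
    u≢x : u ≢ x
    u≢x = proj₁ u≢x×u≢y
    u≢y : u ≢ y
    u≢y = proj₂ u≢x×u≢y
    u≢z : u ≢ z
    u≢z = proj₂ (≢-endpoints u≢c u≢d cd=xz)

  KnMinus2-anchors : 4 < n → a ≢ b → c ≢ d → ¬ SameEdge a b c d → Anchors G
  KnMinus2-anchors 4<n a≢b c≢d ab≠cd with a ≟ c | a ≟ d | b ≟ c | b ≟ d
  ... | yes refl | _        | _        | _        =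
    anchors-shared 4<n a b d a≢b c≢d (λ b≡d → ab≠cd (inj₁ (refl , sym b≡d)))
                   (inj₁ (refl , refl)) (inj₁ (refl , refl))
  ... | no  a≢c  | yes refl | _        | _        =
    anchors-shared 4<n a b c a≢b a≢c (λ b≡c → ab≠cd (inj₂ (sym b≡c , refl)))
                   (inj₁ (refl , refl)) (inj₂ (refl , refl))
  ... | no  _    | no  a≢d  | yes refl | _        =
    anchors-shared 4<n b a d (≢-sym a≢b) c≢d (λ a≡d → ab≠cd (inj₂ (refl , sym a≡d)))
                   (inj₂ (refl , refl)) (inj₁ (refl , refl))
  ... | no  a≢c  | no  _    | no  _    | yes refl =
    anchors-shared 4<n b a c (≢-sym a≢b) (≢-sym c≢d) a≢c
                   (inj₂ (refl , refl)) (inj₂ (refl , refl))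
  ... | no  a≢c  | no  a≢d  | no  b≢c  | no  b≢d  =
    anchors-disjoint a≢b c≢d a≢c a≢d b≢c b≢d

n≤⌈n/2⌉+⌈n/2⌉ : ∀ n → n ≤ ⌈ n /2⌉ + ⌈ n /2⌉
n≤⌈n/2⌉+⌈n/2⌉ n = subst (_≤ ⌈ n /2⌉ + ⌈ n /2⌉) (⌊n/2⌋+⌈n/2⌉≡n n) (+-monoˡ-≤ ⌈ n /2⌉ (⌊n/2⌋≤⌈n/2⌉ n))

mainTheorem5 : (n : ℕ) → 5 ≤ n → (a b c d : Fin n) → ¬ a ≡ b → ¬ c ≡ d → ¬ SameEdge a b c d →
    ∃[ k ] (k ≤ ⌈ n /2⌉ ∸ 1 × CopsWin (KnMinus2 n a b c d) k)
-- Matching n = 2 + n′ makes ⌈ n /2⌉ ∸ 1 reduce to ⌈ n′ /2⌉.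
mainTheorem5 n 5≤n@(s≤s (s≤s _)) a b c d a≢b c≢d ab≠cd =
  ⌈ n /2⌉ ∸ 1 , ≤-refl ,
  copsWin-anchors (KnMinus2-anchors 5≤n a≢b c≢d ab≠cd) (<⇒≤ 5≤n)
                  (∸-monoˡ-≤ 1 (⌈n/2⌉-mono 5≤n)) (s≤s (s≤s (n≤⌈n/2⌉+⌈n/2⌉ _)))
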